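{- Let $G$ be a connected graph with no subgraph isomorphic to $Y$, and let $P=v_0v_1\dots v_\ell$ be a longest path in $G$. Then there is no edge of $G$ with both endpoints in $V(G)\setminus V(P)$.
   Context: All graphs are finite and simple. $Y$ is the 7-vertex tree obtained from $K_{1,3}$ by subdividing each edge exactly once. -}

module Defs where

open import Data.Nat using (ℕ; zero; suc; _≤_)
open import Data.Fin using (Fin; zero; suc; inject₁)
open import Data.Vec using (Vec; lookup)
open import Data.Product using (Σ; _×_; _,_; ∃-syntax)
open import Data.Empty using (⊥)
open import Relation.Nullary using (¬_)
open import Relation.Binary.PropositionalEquality using (_≡_)
open import Function.Definitions using (Injective)

record Graph (n : ℕ) : Set₁ where
  field
    Adj     : Fin n → Fin n → Set
    sym     : ∀ {u v} → Adj u v → Adj v u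
    irrefl  : ∀ {v} → ¬ Adj v v

open Graph public

record Path {n : ℕ} (G : Graph n) (ℓ : ℕ) : Set where
  field
    vert     : Vec (Fin n) (suc ℓ)
    distinct : Injective _≡_ _≡_ (lookup vert)
    adjacent : ∀ (i : Fin ℓ) → Adj G (lookup vert (inject₁ i)) (lookup vert (suc i))

open Path public

IsLongestPath : ∀ {n} (G : Graph n) {ℓ : ℕ} → Path G ℓ → Set
IsLongestPath G {ℓ} P = ∀ (m : ℕ) → Path G m → m ≤ ℓ

OnPath : ∀ {n} {G : Graph n} {ℓ} → Path G ℓ → Fin n → Set
OnPath {ℓ = ℓ} P v = ∃[ i ] lookup (vert P) i ≡ v

Connected : ∀ {n} → Graph n → Set
Connected G = ∀ u v → ∃[ ℓ ] Σ (Path G ℓ) λ P →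
  (lookup (vert P) zero ≡ u) × (lookup (vert P) (Data.Fin.fromℕ ℓ) ≡ v)

-- The tree Y on Fin 7: centre 0; neighbours 1,2,3; leaves 4,5,6 with 4~1, 5~2, 6~3.
-- Edge list (unordered): each listed once.
data YEdge : Fin 7 → Fin 7 → Set where
  e01 : YEdge zero (suc zero)
  e02 : YEdge zero (suc (suc zero))
  e03 : YEdge zero (suc (suc (suc zero)))
  e14 : YEdge (suc zero) (suc (suc (suc (suc zero))))
  e25 : YEdge (suc (suc zero)) (suc (suc (suc (suc (suc zero)))))
  e36 : YEdge (suc (suc (suc zero))) (suc (suc (suc (suc (suc (suc zero))))))

HasYSubgraph : ∀ {n} → Graph n → Set
HasYSubgraph {n} G = Σ (Fin 7 → Fin n) λ f →
  Injective _≡_ _≡_ f × (∀ {a b} → YEdge a b → Adj G (f a) (f b))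

-- Let a–b be an edge avoiding a longest path P = v₀ … v_ℓ. Following a walk from this edge to P, we
-- may assume that a has a neighbour v_c on P. If c ≤ 1, then b a v_c … v_ℓ is a path longer than P,
-- and symmetrically if c ≥ ℓ − 1. Otherwise v_c is the centre of a copy of Y with arms
-- v_{c−1} v_{c−2}, v_{c+1} v_{c+2} and a b.
module Submission where

open import Defs
open import Data.Bool using (Bool; true; false)
open import Data.Nat using (ℕ; zero; suc; _+_; _∸_; _≤_; _<_; z≤n; s≤s; _≤?_)
open import Data.Nat.Properties
  using (≤-refl; ≤-trans; ≤-pred; <⇒≱; ≰⇒>; m≤n+m; m≤n+m∸n; m∸n≤m; ∸-monoˡ-≤;
         +-comm; +-suc; +-identityʳ; +-cancelˡ-≡; +-monoˡ-≤; +-monoʳ-≤;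
         +-∸-assoc; m+n∸n≡m; m+[n∸m]≡n; m∸[m∸n]≡n; m⊓n≤n; m≤n⇒m⊓n≡m)
open import Data.Fin using (Fin; zero; suc; toℕ; fromℕ<; inject₁; fromℕ; _≟_)
open import Data.Fin.Properties using (toℕ-injective; toℕ-fromℕ<; toℕ-inject₁; toℕ<n; any?)
open import Data.Sum using (_⊎_; inj₁; inj₂)
open import Data.Vec using (Vec; _∷_; lookup; tabulate)
open import Data.Vec.Properties using (lookup∘tabulate)
open import Data.Product using (_,_)
open import Data.Empty using (⊥-elim)
open import Function using (_∘_)
open import Function.Definitions using (Injective)
open import Relation.Nullary using (¬_; yes; no; contradiction)
open import Relation.Unary using (Decidable)
open import Relation.Binary.PropositionalEquality
  using (_≡_; _≢_; refl; cong; trans; subst; subst₂; module ≡-Reasoning)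
  renaming (sym to ≡-sym)

-- Clamped: every index beyond m gives the last entry.
vertexAt : ∀ {A : Set} {m} → Vec A (suc m) → ℕ → A
vertexAt {m = m} vs j = lookup vs (fromℕ< (s≤s (m⊓n≤n j m)))

lookup≡vertexAt : ∀ {A : Set} {m} (vs : Vec A (suc m)) (i : Fin (suc m)) {j} →
                  toℕ i ≡ j → lookup vs i ≡ vertexAt vs j
lookup≡vertexAt vs i refl =
  cong (lookup vs) (toℕ-injective (≡-sym (trans (toℕ-fromℕ< _) (m≤n⇒m⊓n≡m (≤-pred (toℕ<n i))))))

-- The copy of Y is built from a path segment Q₀ … Q₄ and an edge a–b: inj₁ i stands for Qᵢ,
-- inj₂ true for a and inj₂ false for b, with centre Q₂ and arms Q₁Q₀, Q₃Q₄ and a b.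
yRole : Fin 7 → Fin 5 ⊎ Bool
yRole zero                                     = inj₁ (suc (suc zero))
yRole (suc zero)                               = inj₁ (suc zero)
yRole (suc (suc zero))                         = inj₁ (suc (suc (suc zero)))
yRole (suc (suc (suc zero)))                   = inj₂ true
yRole (suc (suc (suc (suc zero))))             = inj₁ zero
yRole (suc (suc (suc (suc (suc zero)))))       = inj₁ (suc (suc (suc (suc zero))))
yRole (suc (suc (suc (suc (suc (suc zero)))))) = inj₂ false

yRole⁻¹ : Fin 5 ⊎ Bool → Fin 7
yRole⁻¹ (inj₁ zero)                             = suc (suc (suc (suc zero)))
yRole⁻¹ (inj₁ (suc zero))                       = suc zero
yRole⁻¹ (inj₁ (suc (suc zero)))                 = zero
yRole⁻¹ (inj₁ (suc (suc (suc zero))))           = suc (suc zero)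
yRole⁻¹ (inj₁ (suc (suc (suc (suc zero)))))     = suc (suc (suc (suc (suc zero))))
yRole⁻¹ (inj₂ true)                             = suc (suc (suc zero))
yRole⁻¹ (inj₂ false)                            = suc (suc (suc (suc (suc (suc zero)))))

yRole⁻¹-yRole : ∀ x → yRole⁻¹ (yRole x) ≡ x
yRole⁻¹-yRole zero                                     = refl
yRole⁻¹-yRole (suc zero)                               = refl
yRole⁻¹-yRole (suc (suc zero))                         = refl
yRole⁻¹-yRole (suc (suc (suc zero)))                   = refl
yRole⁻¹-yRole (suc (suc (suc (suc zero))))             = refl
yRole⁻¹-yRole (suc (suc (suc (suc (suc zero)))))       = refl
yRole⁻¹-yRole (suc (suc (suc (suc (suc (suc zero)))))) = refl

yRole-injective : Injective _≡_ _≡_ yRole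
yRole-injective {x} {y} eq =
  trans (≡-sym (yRole⁻¹-yRole x)) (trans (cong yRole⁻¹ eq) (yRole⁻¹-yRole y))

module _ {n : ℕ} (G : Graph n) where

  -- Paths indexed by ℕ rather than Fin, so that reversal and suffixes need no Fin arithmetic;
  -- only the indices 0 … m are meaningful.
  record ℕPath (m : ℕ) : Set where
    field
      vertex           : ℕ → Fin n
      vertex-injective : ∀ {j k} → j ≤ m → k ≤ m → vertex j ≡ vertex k → j ≡ k
      vertex-adjacent  : ∀ {j} → j < m → Adj G (vertex j) (vertex (suc j))

  open ℕPath

  Avoids : ∀ {m} → ℕPath m → Fin n → Set
  Avoids {m} Q x = ∀ {j} → j ≤ m → vertex Q j ≢ x

  toPath : ∀ {m} → ℕPath m → Path G m
  toPath {m} Q = record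
    { vert     = tabulate v
    ; distinct = λ {i} {k} eq → toℕ-injective
        (vertex-injective Q (≤-pred (toℕ<n i)) (≤-pred (toℕ<n k))
          (trans (≡-sym (lookup∘tabulate v i)) (trans eq (lookup∘tabulate v k))))
    ; adjacent = λ i → subst₂ (Adj G)
        (trans (cong (vertex Q) (≡-sym (toℕ-inject₁ i))) (≡-sym (lookup∘tabulate v (inject₁ i))))
        (≡-sym (lookup∘tabulate v (suc i)))
        (vertex-adjacent Q (toℕ<n i))
    }
    where
    v : Fin (suc m) → Fin n
    v = vertex Q ∘ toℕ

  fromPath : ∀ {ℓ} → Path G ℓ → ℕPath ℓ
  fromPath {ℓ} P = record
    { vertex           = vertexAt (vert P)
    ; vertex-injective = injective
    ; vertex-adjacent  = adjacent′
    }
    where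
    at : ∀ i {j} → toℕ i ≡ j → lookup (vert P) i ≡ vertexAt (vert P) j
    at = lookup≡vertexAt (vert P)

    injective : ∀ {j k} → j ≤ ℓ → k ≤ ℓ → vertexAt (vert P) j ≡ vertexAt (vert P) k → j ≡ k
    injective {j} {k} j≤ℓ k≤ℓ eq = begin
      j                      ≡⟨ ≡-sym (toℕ-fromℕ< (s≤s j≤ℓ)) ⟩
      toℕ (fromℕ< (s≤s j≤ℓ)) ≡⟨ cong toℕ (distinct P same-vertex) ⟩
      toℕ (fromℕ< (s≤s k≤ℓ)) ≡⟨ toℕ-fromℕ< (s≤s k≤ℓ) ⟩
      k                      ∎
      where
      open ≡-Reasoning
      same-vertex : lookup (vert P) (fromℕ< (s≤s j≤ℓ)) ≡ lookup (vert P) (fromℕ< (s≤s k≤ℓ))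
      same-vertex = trans (at _ (toℕ-fromℕ< _)) (trans eq (≡-sym (at _ (toℕ-fromℕ< _))))

    adjacent′ : ∀ {j} → j < ℓ → Adj G (vertexAt (vert P) j) (vertexAt (vert P) (suc j))
    adjacent′ j<ℓ = subst₂ (Adj G)
      (at (inject₁ i) (trans (toℕ-inject₁ i) (toℕ-fromℕ< j<ℓ)))
      (at (suc i) (cong suc (toℕ-fromℕ< j<ℓ)))
      (adjacent P i)
      where
      i = fromℕ< j<ℓ

  fromPath-avoids : ∀ {ℓ} (P : Path G ℓ) {x} → ¬ OnPath P x → Avoids (fromPath P) x
  fromPath-avoids P x∉P j≤ℓ eq =
    x∉P (fromℕ< (s≤s j≤ℓ) , trans (lookup≡vertexAt (vert P) _ (toℕ-fromℕ< _)) eq)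

  reverse : ∀ {m} → ℕPath m → ℕPath m
  reverse {m} Q = record
    { vertex           = λ j → vertex Q (m ∸ j)
    ; vertex-injective = λ {j} {k} j≤m k≤m eq → begin
        j             ≡⟨ ≡-sym (m∸[m∸n]≡n j≤m) ⟩
        m ∸ (m ∸ j)   ≡⟨ cong (m ∸_) (vertex-injective Q (m∸n≤m m j) (m∸n≤m m k) eq) ⟩
        m ∸ (m ∸ k)   ≡⟨ m∸[m∸n]≡n k≤m ⟩
        k             ∎
    ; vertex-adjacent  = λ {j} j<m →
        subst (λ i → Adj G (vertex Q i) (vertex Q (m ∸ suc j))) (≡-sym (+-∸-assoc 1 j<m))
          (Graph.sym G (vertex-adjacent Q (subst (_≤ m) (+-∸-assoc 1 j<m) (m∸n≤m m j))))
    }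
    where open ≡-Reasoning

  reverse-avoids : ∀ {m} (Q : ℕPath m) → ∀ {x} → Avoids Q x → Avoids (reverse Q) x
  reverse-avoids {m} Q x∉Q {j} _ = x∉Q (m∸n≤m m j)

  module _ {m c : ℕ} (c≤m : c ≤ m) where

    private
      shift-≤ : ∀ {j} → j ≤ m ∸ c → c + j ≤ m
      shift-≤ {j} j≤ = subst (c + j ≤_) (m+[n∸m]≡n c≤m) (+-monoʳ-≤ c j≤)

    drop : ℕPath m → ℕPath (m ∸ c)
    drop Q = record
      { vertex           = λ j → vertex Q (c + j)
      ; vertex-injective = λ {j} {k} j≤ k≤ eq →
          +-cancelˡ-≡ c j k (vertex-injective Q (shift-≤ j≤) (shift-≤ k≤) eq)
      ; vertex-adjacent  = λ {j} j< →
          subst (λ i → Adj G (vertex Q (c + j)) (vertex Q i)) (≡-sym (+-suc c j))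
            (vertex-adjacent Q (subst (_≤ m) (+-suc c j) (shift-≤ j<)))
      }

    drop-avoids : (Q : ℕPath m) → ∀ {x} → Avoids Q x → Avoids (drop Q) x
    drop-avoids Q x∉Q j≤ = x∉Q (shift-≤ j≤)

  prepend : ∀ {m} x (Q : ℕPath m) → Avoids Q x → Adj G x (vertex Q 0) → ℕPath (suc m)
  prepend {m} x Q x∉Q x~Q₀ = record
    { vertex           = v
    ; vertex-injective = injective
    ; vertex-adjacent  = adjacent′
    }
    where
    v : ℕ → Fin n
    v zero    = x
    v (suc j) = vertex Q j

    injective : ∀ {j k} → j ≤ suc m → k ≤ suc m → v j ≡ v k → j ≡ k
    injective {zero}  {zero}  _         _         _  = refl
    injective {zero}  {suc k} _         (s≤s k≤m) eq = contradiction (≡-sym eq) (x∉Q k≤m)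
    injective {suc j} {zero}  (s≤s j≤m) _         eq = contradiction eq (x∉Q j≤m)
    injective {suc j} {suc k} (s≤s j≤m) (s≤s k≤m) eq = cong suc (vertex-injective Q j≤m k≤m eq)

    adjacent′ : ∀ {j} → j < suc m → Adj G (v j) (v (suc j))
    adjacent′ {zero}  _         = x~Q₀
    adjacent′ {suc j} (s≤s j<m) = vertex-adjacent Q j<m

  prepend-avoids : ∀ {m} {x} (Q : ℕPath m) (x∉Q : Avoids Q x) (x~Q₀ : Adj G x (vertex Q 0)) → ∀ {y} →
                   x ≢ y → Avoids Q y → Avoids (prepend x Q x∉Q x~Q₀) y
  prepend-avoids Q _ _ x≢y _   {zero}  _         = x≢y
  prepend-avoids Q _ _ _   y∉Q {suc j} (s≤s j≤m) = y∉Q j≤m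

  adjacent⇒≢ : ∀ {x y} → Adj G x y → x ≢ y
  adjacent⇒≢ {x} x~y x≡y = irrefl G (subst (Adj G x) (≡-sym x≡y) x~y)

  extendThroughEdge : ∀ {m c a b} (Q : ℕPath m) → Avoids Q a → Avoids Q b → Adj G a b →
                      c ≤ m → Adj G (vertex Q c) a → ℕPath (2 + (m ∸ c))
  extendThroughEdge {m} {c} {a} {b} Q a∉Q b∉Q a~b c≤m Qc~a =
    prepend b (prepend a suffix a∉suffix a~Qc)
      (prepend-avoids suffix a∉suffix a~Qc (adjacent⇒≢ a~b) (drop-avoids c≤m Q b∉Q))
      (Graph.sym G a~b)
    where
    suffix : ℕPath (m ∸ c)
    suffix = drop c≤m Q

    a∉suffix : Avoids suffix a
    a∉suffix = drop-avoids c≤m Q a∉Q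

    a~Qc : Adj G a (vertex suffix 0)
    a~Qc = subst (λ i → Adj G a (vertex Q i)) (≡-sym (+-identityʳ c)) (Graph.sym G Qc~a)

  PathLengthsAtMost : ℕ → Set
  PathLengthsAtMost ℓ = ∀ {m} → ℕPath m → m ≤ ℓ

  ¬hangingEdge-nearStart : ∀ {ℓ c a b} → PathLengthsAtMost ℓ → (Q : ℕPath ℓ) →
                           Avoids Q a → Avoids Q b → Adj G a b → c ≤ 1 → c ≤ ℓ → ¬ Adj G (vertex Q c) a
  ¬hangingEdge-nearStart {ℓ} {c} bound Q a∉Q b∉Q a~b c≤1 c≤ℓ Qc~a =
    <⇒≱ (s≤s (≤-trans (m≤n+m∸n ℓ c) (+-monoˡ-≤ (ℓ ∸ c) c≤1)))
        (bound (extendThroughEdge Q a∉Q b∉Q a~b c≤ℓ Qc~a))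

  interiorHangingEdge⇒Y : ∀ {m a b} (Q : ℕPath m) → 4 ≤ m → Avoids Q a → Avoids Q b → Adj G a b →
                          Adj G (vertex Q 2) a → HasYSubgraph G
  interiorHangingEdge⇒Y {m} {a} {b} Q 4≤m a∉Q b∉Q a~b Q₂~a =
    embed ∘ yRole , yRole-injective ∘ embed-injective , edge
    where
    embed : Fin 5 ⊎ Bool → Fin n
    embed (inj₁ i)     = vertex Q (toℕ i)
    embed (inj₂ true)  = a
    embed (inj₂ false) = b

    index-≤ : (i : Fin 5) → toℕ i ≤ m
    index-≤ i = ≤-trans (≤-pred (toℕ<n i)) 4≤m

    embed-injective : Injective _≡_ _≡_ embed
    embed-injective {inj₁ i}     {inj₁ k}     eq =
      cong inj₁ (toℕ-injective (vertex-injective Q (index-≤ i) (index-≤ k) eq))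
    embed-injective {inj₁ i}     {inj₂ true}  eq = contradiction eq (a∉Q (index-≤ i))
    embed-injective {inj₁ i}     {inj₂ false} eq = contradiction eq (b∉Q (index-≤ i))
    embed-injective {inj₂ true}  {inj₁ k}     eq = contradiction (≡-sym eq) (a∉Q (index-≤ k))
    embed-injective {inj₂ false} {inj₁ k}     eq = contradiction (≡-sym eq) (b∉Q (index-≤ k))
    embed-injective {inj₂ true}  {inj₂ true}  _  = refl
    embed-injective {inj₂ true}  {inj₂ false} eq = contradiction eq (adjacent⇒≢ a~b)
    embed-injective {inj₂ false} {inj₂ true}  eq = contradiction (≡-sym eq) (adjacent⇒≢ a~b)
    embed-injective {inj₂ false} {inj₂ false} _  = refl

    step : (i : Fin 4) → Adj G (vertex Q (toℕ i)) (vertex Q (suc (toℕ i)))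
    step i = vertex-adjacent Q (≤-trans (toℕ<n i) 4≤m)

    edge : ∀ {x y} → YEdge x y → Adj G (embed (yRole x)) (embed (yRole y))
    edge e01 = Graph.sym G (step (suc zero))
    edge e02 = step (suc (suc zero))
    edge e03 = Q₂~a
    edge e14 = Graph.sym G (step zero)
    edge e25 = step (suc (suc (suc zero)))
    edge e36 = a~b

  hangingEdge⇒Y : ∀ {ℓ c a b} → PathLengthsAtMost ℓ → (Q : ℕPath ℓ) →
                  Avoids Q a → Avoids Q b → Adj G a b → c ≤ ℓ → Adj G (vertex Q c) a → HasYSubgraph G
  hangingEdge⇒Y {c = zero} bound Q a∉Q b∉Q a~b c≤ℓ Qc~a =
    ⊥-elim (¬hangingEdge-nearStart bound Q a∉Q b∉Q a~b z≤n c≤ℓ Qc~a)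
  hangingEdge⇒Y {c = suc zero} bound Q a∉Q b∉Q a~b c≤ℓ Qc~a =
    ⊥-elim (¬hangingEdge-nearStart bound Q a∉Q b∉Q a~b ≤-refl c≤ℓ Qc~a)
  hangingEdge⇒Y {ℓ} {c = suc (suc k)} {a} bound Q a∉Q b∉Q a~b c≤ℓ Qc~a with 4 + k ≤? ℓ
  ... | yes 4+k≤ℓ =
    interiorHangingEdge⇒Y (drop k≤ℓ Q) 4≤ℓ∸k (drop-avoids k≤ℓ Q a∉Q) (drop-avoids k≤ℓ Q b∉Q) a~b
      (subst (λ i → Adj G (vertex Q i) a) (+-comm 2 k) Qc~a)
    where
    k≤ℓ : k ≤ ℓ
    k≤ℓ = ≤-trans (m≤n+m k 2) c≤ℓ
    4≤ℓ∸k : 4 ≤ ℓ ∸ k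
    4≤ℓ∸k = subst (_≤ ℓ ∸ k) (m+n∸n≡m 4 k) (∸-monoˡ-≤ k 4+k≤ℓ)
  ... | no 4+k≰ℓ =
    ⊥-elim (¬hangingEdge-nearStart bound (reverse Q) (reverse-avoids Q a∉Q) (reverse-avoids Q b∉Q) a~b
              ℓ∸c≤1 (m∸n≤m ℓ (2 + k))
              (subst (λ i → Adj G (vertex Q i) a) (≡-sym (m∸[m∸n]≡n c≤ℓ)) Qc~a))
    where
    ℓ∸c≤1 : ℓ ∸ (2 + k) ≤ 1
    ℓ∸c≤1 = subst (ℓ ∸ (2 + k) ≤_) (m+n∸n≡m 1 (2 + k))
                  (∸-monoˡ-≤ (2 + k) (≤-pred (≰⇒> 4+k≰ℓ)))

  onPath? : ∀ {ℓ} (P : Path G ℓ) → Decidable (OnPath P)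
  onPath? P x = any? (λ i → lookup (vert P) i ≟ x)

  IsWalk : ∀ {m} → Vec (Fin n) (suc m) → Set
  IsWalk {m} vs = ∀ (i : Fin m) → Adj G (lookup vs (inject₁ i)) (lookup vs (suc i))

  record HangingEdge (S : Fin n → Set) : Set where
    field
      anchor a b : Fin n
      anchor∈S   : S anchor
      a∉S        : ¬ S a
      b∉S        : ¬ S b
      anchor~a   : Adj G anchor a
      a~b        : Adj G a b

  walk⇒hangingEdge : ∀ {S : Fin n → Set} → Decidable S → ∀ {m} (vs : Vec (Fin n) (suc m)) → IsWalk vs →
                     S (lookup vs (fromℕ m)) → ¬ S (lookup vs zero) →
                     ∀ {y} → ¬ S y → Adj G (lookup vs zero) y → HangingEdge S
  walk⇒hangingEdge S? {zero} (x ∷ _) _ x∈S x∉S _ _ = contradiction x∈S x∉S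
  walk⇒hangingEdge S? {suc m} (x ∷ x′ ∷ vs) walk end∈S x∉S {y} y∉S x~y with S? x′
  ... | yes x′∈S = record
    { anchor = x′ ; a = x ; b = y ; anchor∈S = x′∈S ; a∉S = x∉S ; b∉S = y∉S
    ; anchor~a = Graph.sym G (walk zero) ; a~b = x~y }
  ... | no x′∉S = walk⇒hangingEdge S? (x′ ∷ vs) (walk ∘ suc) end∈S x′∉S x∉S (Graph.sym G (walk zero))

lemma2p3 : ∀ {n : ℕ} (G : Graph n) → Connected G → ¬ HasYSubgraph G →
    ∀ {ℓ : ℕ} (P : Path G ℓ) → IsLongestPath G P →
    ∀ (u v : Fin n) → ¬ OnPath P u → ¬ OnPath P v → ¬ Adj G u v
lemma2p3 G conn noY P longest u v u∉P v∉P u~v with conn u (lookup (vert P) zero)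
... | _ , W , refl , Wₘ≡P₀
    with walk⇒hangingEdge G (onPath? G P) (vert W) (adjacent W) (zero , ≡-sym Wₘ≡P₀) u∉P v∉P u~v
... | record { anchor∈S = i , Pᵢ≡anchor ; a∉S = a∉P ; b∉S = b∉P ; anchor~a = anchor~a ; a~b = a~b } =
  noY (hangingEdge⇒Y G (λ Q → longest _ (toPath G Q)) (fromPath G P)
         (fromPath-avoids G P a∉P) (fromPath-avoids G P b∉P) a~b (≤-pred (toℕ<n i))
         (subst (λ x → Adj G x _) (trans (≡-sym Pᵢ≡anchor) (lookup≡vertexAt (vert P) i refl)) anchor~a))
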